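{- Let $\mathbb{F}$ be a field of characteristic $0$, $n\ge 4$ and $2\le t\le n-2$. Consider the $n\times n$ matrix of variables $[x_{ij}]$, let $Y'=\{x_{ui}:1\le u\le t,\ i\in[1,n]\}$ and let $Z=\{x_{ui}: t+1\le u\le n,\ i\in[1,n]\}$ (an $(n-t)\times n$ matrix of variables). Define $f:\mathbb{F}^{tn}\to Pol^{n-t}_{hom}(\mathbb{F}\langle Z\rangle)$ by $f(\lambda)=Per_n(\lambda,Z)$, i.e. the permanent with the first $t$ rows specialised to $\lambda\in\mathbb{F}^{tn}$, viewed as a polynomial in $Z$. Let $\overline{Per}(Z)$ be the linear subspace of $Pol^{n-t}_{hom}(\mathbb{F}\langle Z\rangle)$ spanned by the permanents of the $(n-t)\times(n-t)$ submatrices of $Z$. Then the linear span of $f(\mathbb{F}^{tn})$ is $\overline{Per}(Z)$. Hence $f$ is $(s,1)$-weakly elusive for $s=\binom{n}{n-t}-1$.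
   Context: $Per_n([x_{ij}])=\sum_{\sigma\in\Sigma_n}\prod_{i=1}^n x_{i\sigma(i)}$. $Pol^{n-t}_{hom}(\mathbb{F}\langle Z\rangle)$ is the space of homogeneous polynomials of degree $n-t$ in the variables $Z$, identified with $\mathbb{F}^N$ via monomial coefficients. A polynomial mapping $g:\mathbb{F}^a\to\mathbb{F}^b$ is $(s,q)$-weakly elusive if its image is not contained in the image of any homogeneous polynomial mapping $\Gamma:\mathbb{F}^s\to\mathbb{F}^b$ of degree $q$. -}

module Defs where

open import Level using (Level; _⊔_)
open import Algebra.Bundles using (CommutativeRing)
open import Data.Nat as ℕ using (ℕ; zero; suc; _<_; _≤_)

open import Data.Fin as Fin using (Fin; _↑ˡ_; _↑ʳ_)
open import Data.Fin.Properties using () renaming (_≟_ to _≟F_)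
open import Data.Vec.Functional using (_∷_)
open import Data.Bool using (Bool; true; false; if_then_else_; _∧_; not)
open import Data.Product using (Σ; ∃; _×_; _,_)
open import Relation.Nullary using (¬_)
open import Relation.Nullary.Decidable using (⌊_⌋)
open import Relation.Binary.PropositionalEquality using (_≡_)

sumℕ : ∀ {k} → (Fin k → ℕ) → ℕ
sumℕ {zero}  f = 0
sumℕ {suc k} f = f Fin.zero ℕ.+ sumℕ (λ i → f (Fin.suc i))

allB : ∀ {k} → (Fin k → Bool) → Bool
allB {zero}  f = true
allB {suc k} f = f Fin.zero ∧ allB (λ i → f (Fin.suc i))

degree : ∀ {r m} → (Fin r → Fin m → ℕ) → ℕ
degree e = sumℕ (λ u → sumℕ (λ i → e u i))

Mono : ℕ → ℕ → ℕ → Set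
Mono r m d = Σ (Fin r → Fin m → ℕ) (λ e → degree e ≡ d)

isInj : ∀ {k m} → (Fin k → Fin m) → Bool
isInj {k} σ = allB (λ i → allB (λ j → ⌊ i ≟F j ⌋ ∨' not ⌊ σ i ≟F σ j ⌋))
  where
  _∨'_ : Bool → Bool → Bool
  true  ∨' b = true
  false ∨' b = b

-- strictly increasing map  Fin k → Fin m  (a choice of k columns out of m)
StrictlyIncreasing : ∀ {k m} → (Fin k → Fin m) → Set
StrictlyIncreasing c = ∀ i j → i Fin.< j → c i Fin.< c j

-- exponent matrix of the monomial  ∏_u z_{u, ρ(u)} : is it equal to e ?
isMonoOf : ∀ {r m} → (Fin r → Fin m) → (Fin r → Fin m → ℕ) → Bool
isMonoOf ρ e = allB (λ u → allB (λ i →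
  ⌊ e u i ℕ.≟ (if ⌊ ρ u ≟F i ⌋ then 1 else 0) ⌋))

record IsField {c ℓ : Level} (R : CommutativeRing c ℓ) : Set (c ⊔ ℓ) where
  open CommutativeRing R
  field
    0≉1 : ¬ (0# ≈ 1#)
    inverse : ∀ x → ¬ (x ≈ 0#) → ∃ λ y → (x * y) ≈ 1#

module _ {c ℓ : Level} (R : CommutativeRing c ℓ) where
  open CommutativeRing R

  natF : ℕ → Carrier
  natF zero    = 0#
  natF (suc k) = 1# + natF k

  CharZero : Set ℓ
  CharZero = ∀ k → ¬ (natF (suc k) ≈ 0#)

  sumF : ∀ {k} → (Fin k → Carrier) → Carrier
  sumF {zero}  f = 0#
  sumF {suc k} f = f Fin.zero + sumF (λ i → f (Fin.suc i))

  prodF : ∀ {k} → (Fin k → Carrier) → Carrier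
  prodF {zero}  f = 1#
  prodF {suc k} f = f Fin.zero * prodF (λ i → f (Fin.suc i))

  sumMaps : ∀ {k m} → ((Fin k → Fin m) → Carrier) → Carrier
  sumMaps {zero}      g = g (λ ())
  sumMaps {suc k} {m} g = sumF (λ i → sumMaps (λ h → g (i ∷ h)))

  -- sum over the symmetric group Σ_m (as the injective self-maps of Fin m)
  sumPerm : ∀ {m} → ((Fin m → Fin m) → Carrier) → Carrier
  sumPerm g = sumMaps (λ σ → if isInj σ then g σ else 0#)

  -- Pol^d_hom(F⟨Z⟩), Z an r × m matrix of variables, identified with
  -- the coefficient vectors indexed by monomials of degree d.
  Pol : ℕ → ℕ → ℕ → Set c
  Pol r m d = Mono r m d → Carrier

  -- Per_n(λ, Z) with n = t + r, the first t rows specialised to λ and the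
  -- last r rows the variables Z; as a polynomial in Z (coefficientwise):
  --   Per_n = Σ_σ ∏_{u<t} λ_{u σ(u)} ∏_{u<r} z_{u σ(t+u)}
  perSpec : (t r : ℕ) → (Fin t → Fin (t ℕ.+ r) → Carrier) → Pol r (t ℕ.+ r) r
  perSpec t r lam (e , _) = sumPerm (λ σ →
    if isMonoOf (λ u → σ (t ↑ʳ u)) e
      then prodF (λ u → lam u (σ (u ↑ˡ r)))
      else 0#)

  perSub : (r m : ℕ) → (Fin r → Fin m) → Pol r m r
  perSub r m c (e , _) = sumPerm (λ τ →
    if isMonoOf (λ u → c (τ u)) e then 1# else 0#)

  InSpan : ∀ {a} {I : Set} → ((I → Carrier) → Set a) → (I → Carrier) → Set (c ⊔ ℓ ⊔ a)
  InSpan {I = I} A p =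
    ∃ λ (k : ℕ) → ∃ λ (coef : Fin k → Carrier) → ∃ λ (v : Fin k → I → Carrier) →
      (∀ j → A (v j)) × (∀ x → p x ≈ sumF (λ j → coef j * v j x))

  -- homogeneous polynomial mapping  Γ : F^s → F^I  of degree q, written as
  --   Γ(y)_x = Σ_{w : Fin q → Fin s} C_x(w) ∏_{j<q} y_{w(j)}
  -- (every homogeneous polynomial of degree q in s variables has this form)
  homMap : ∀ {I : Set} (s q : ℕ) → (I → (Fin q → Fin s) → Carrier) →
           (Fin s → Carrier) → I → Carrier
  homMap s q Cf y x = sumMaps (λ w → Cf x w * prodF (λ j → y (w j)))

  -- g : F^a → F^I is (s,q)-weakly elusive: its image is not contained in the
  -- image of any homogeneous polynomial mapping F^s → F^I of degree q.
  -- (the domain F^a is given as any type D of coordinate vectors, e.g. Fin a → Carrier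
  --  or Fin t → Fin n → Carrier for F^{tn})
  WeaklyElusive : ∀ {d} {D : Set d} {I : Set} (s q : ℕ) → (D → I → Carrier) → Set (c ⊔ ℓ ⊔ d)
  WeaklyElusive {D = D} {I} s q g =
    ∀ (Cf : I → (Fin q → Fin s) → Carrier) →
      ¬ (∀ (y : D) → ∃ λ (z : Fin s → Carrier) →
           ∀ x → g y x ≈ homMap s q Cf z x)

-- Expanding every specialised row λ_u = Σ_j λ_{u j} e_j multilinearly writes Per(λ, Z) as a combination of the
-- Per(E_π, Z), where E_π has the unit rows e_{π(1)}, …, e_{π(t)}.  Per(E_π, Z) vanishes unless π is injective, and
-- then it is the permanent of the r × r submatrix of Z on the columns π misses; every such subpermanent arises
-- this way, so both families span the same space.  For each r-set b of columns let E_b be the matrix whose rows are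
-- the columns outside b: the coefficient of the diagonal monomial of the column set a in Per(E_b, Z) is δ_{ab}.
-- If Per(·, Z) took values in the image of a linear map from F^s, this identity matrix of size (t+r choose r) would
-- factor through F^s, which Gaussian elimination forbids for s < (t+r choose r).

module Submission where

open import Defs
open import Algebra.Bundles using (CommutativeRing)
open import Level using (_⊔_)
open import Data.Bool using (Bool; true; false; if_then_else_)
open import Data.Empty using (⊥-elim)
open import Data.Fin as Fin using (Fin; _↑ˡ_; _↑ʳ_; splitAt; punchIn; punchOut; cast)
import Data.Fin.Properties as Finₚ
open import Data.Nat as ℕ using (ℕ; zero; suc; _≤_; _<_; _∸_; s≤s; z≤n)
import Data.Nat.Properties as ℕₚ
open import Data.Nat.Combinatorics using (_C_; nCk+nC[k+1]≡[n+1]C[k+1])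
open import Data.Product using (Σ; ∃; _×_; _,_; proj₁; proj₂)
open import Data.Sum as Sum using (_⊎_; inj₁; inj₂)
open import Data.Vec.Functional using (_∷_; _++_)
open import Data.Vec.Functional.Properties using (∷-cong; ++-cong; lookup-++ˡ; lookup-++ʳ)
open import Function.Base using (_∘_; id)
open import Function.Bundles using (_⇔_; mk⇔)
open import Function.Definitions using (Injective)
open import Relation.Binary.PropositionalEquality as ≡ using (_≡_; _≢_; _≗_; refl; cong)
open import Relation.Binary.Definitions using (tri<; tri≈; tri>)
open import Relation.Nullary using (¬_; Dec; yes; no; contradiction)
open import Relation.Nullary.Decidable using (⌊_⌋; ¬?; decidable-stable)

module _ {c ℓ} (R : CommutativeRing c ℓ) where
  open CommutativeRing R renaming (refl to ≈-refl; sym to ≈-sym; trans to ≈-trans)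
  open import Algebra.Properties.CommutativeSemigroup +-commutativeSemigroup using (interchange)

  sumF-cong : ∀ {k} {f g : Fin k → Carrier} → (∀ i → f i ≈ g i) → sumF R f ≈ sumF R g
  sumF-cong {zero}  f≈g = ≈-refl
  sumF-cong {suc k} f≈g = +-cong (f≈g Fin.zero) (sumF-cong (f≈g ∘ Fin.suc))

  sumF-zero : ∀ {k} {f : Fin k → Carrier} → (∀ i → f i ≈ 0#) → sumF R f ≈ 0#
  sumF-zero {zero}  f≈0 = ≈-refl
  sumF-zero {suc k} f≈0 = ≈-trans (+-cong (f≈0 Fin.zero) (sumF-zero (f≈0 ∘ Fin.suc))) (+-identityˡ 0#)

  sumF-distrib-+ : ∀ {k} (f g : Fin k → Carrier) → sumF R (λ i → f i + g i) ≈ sumF R f + sumF R g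
  sumF-distrib-+ {zero}  f g = ≈-sym (+-identityˡ 0#)
  sumF-distrib-+ {suc k} f g =
    ≈-trans (+-congˡ (sumF-distrib-+ (f ∘ Fin.suc) (g ∘ Fin.suc))) (interchange _ _ _ _)

  *-distribˡ-sumF : ∀ {k} a (f : Fin k → Carrier) → a * sumF R f ≈ sumF R (λ i → a * f i)
  *-distribˡ-sumF {zero}  a f = zeroʳ a
  *-distribˡ-sumF {suc k} a f = ≈-trans (distribˡ a _ _) (+-congˡ (*-distribˡ-sumF a (f ∘ Fin.suc)))

  sumF-comm : ∀ {k l} (f : Fin k → Fin l → Carrier) →
              sumF R (λ i → sumF R (f i)) ≈ sumF R (λ j → sumF R (λ i → f i j))
  sumF-comm {zero} {l} f = ≈-sym (sumF-zero {l} (λ _ → ≈-refl))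
  sumF-comm {suc k} f =
    ≈-trans (+-congˡ (sumF-comm (f ∘ Fin.suc))) (≈-sym (sumF-distrib-+ (f Fin.zero) _))

  sumF-single : ∀ {k} (f : Fin k → Carrier) i₀ → (∀ i → i ≢ i₀ → f i ≈ 0#) → sumF R f ≈ f i₀
  sumF-single f Fin.zero       f≈0 =
    ≈-trans (+-congˡ (sumF-zero (λ i → f≈0 (Fin.suc i) (λ ())))) (+-identityʳ _)
  sumF-single f (Fin.suc i₀) f≈0 =
    ≈-trans (+-congʳ (f≈0 Fin.zero (λ ())))
      (≈-trans (+-identityˡ _)
        (sumF-single (f ∘ Fin.suc) i₀ (λ i i≢i₀ → f≈0 (Fin.suc i) (i≢i₀ ∘ Finₚ.suc-injective))))

  sumMaps-cong : ∀ {k m} {f g : (Fin k → Fin m) → Carrier} → (∀ h → f h ≈ g h) →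
                 sumMaps R f ≈ sumMaps R g
  sumMaps-cong {zero}  f≈g = f≈g _
  sumMaps-cong {suc k} f≈g = sumF-cong (λ i → sumMaps-cong (λ h → f≈g (i ∷ h)))

  sumMaps-zero : ∀ {k m} {f : (Fin k → Fin m) → Carrier} → (∀ h → f h ≈ 0#) → sumMaps R f ≈ 0#
  sumMaps-zero {zero}  f≈0 = f≈0 _
  sumMaps-zero {suc k} f≈0 = sumF-zero (λ i → sumMaps-zero (λ h → f≈0 (i ∷ h)))

  *-distribˡ-sumMaps : ∀ {k m} a (f : (Fin k → Fin m) → Carrier) →
                       a * sumMaps R f ≈ sumMaps R (λ h → a * f h)
  *-distribˡ-sumMaps {zero}  a f = ≈-refl
  *-distribˡ-sumMaps {suc k} a f =
    ≈-trans (*-distribˡ-sumF a (λ i → sumMaps R (λ h → f (i ∷ h))))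
      (sumF-cong (λ i → *-distribˡ-sumMaps a (λ h → f (i ∷ h))))

  sumMaps-single : ∀ {k m} (f : (Fin k → Fin m) → Carrier) h₀ {v} →
                   (∀ h → h ≗ h₀ → f h ≈ v) → (∀ h → ¬ h ≗ h₀ → f h ≈ 0#) → sumMaps R f ≈ v
  sumMaps-single {zero}  f h₀ f≈v f≈0 = f≈v _ (λ ())
  sumMaps-single {suc k} f h₀ f≈v f≈0 =
    ≈-trans (sumF-single (λ i → sumMaps R (λ h → f (i ∷ h))) (h₀ Fin.zero)
               (λ i i≢ → sumMaps-zero (λ h → f≈0 (i ∷ h) (λ eq → i≢ (eq Fin.zero)))))
      (sumMaps-single (λ h → f (h₀ Fin.zero ∷ h)) (h₀ ∘ Fin.suc)
        (λ h eq → f≈v (h₀ Fin.zero ∷ h) (∷-cong refl eq))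
        (λ h ≉ → f≈0 (h₀ Fin.zero ∷ h) (λ eq → ≉ (eq ∘ Fin.suc))))

  sumF-sumMaps-comm : ∀ {k l m} (f : Fin k → (Fin l → Fin m) → Carrier) →
                      sumF R (λ i → sumMaps R (f i)) ≈ sumMaps R (λ h → sumF R (λ i → f i h))
  sumF-sumMaps-comm {l = zero}  f = ≈-refl
  sumF-sumMaps-comm {l = suc l} f =
    ≈-trans (sumF-comm (λ i j → sumMaps R (λ h → f i (j ∷ h))))
      (sumF-cong (λ j → sumF-sumMaps-comm (λ i h → f i (j ∷ h))))

  sumMaps-comm : ∀ {k m l n} (f : (Fin k → Fin m) → (Fin l → Fin n) → Carrier) →
                 sumMaps R (λ g → sumMaps R (f g)) ≈ sumMaps R (λ h → sumMaps R (λ g → f g h))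
  sumMaps-comm {zero}  f = ≈-refl
  sumMaps-comm {suc k} f =
    ≈-trans (sumF-cong (λ i → sumMaps-comm (λ g → f (i ∷ g))))
      (sumF-sumMaps-comm (λ i h → sumMaps R (λ g → f (i ∷ g) h)))

  prodF-cong : ∀ {k} {f g : Fin k → Carrier} → (∀ i → f i ≈ g i) → prodF R f ≈ prodF R g
  prodF-cong {zero}  f≈g = ≈-refl
  prodF-cong {suc k} f≈g = *-cong (f≈g Fin.zero) (prodF-cong (f≈g ∘ Fin.suc))

  prodF-one : ∀ {k} {f : Fin k → Carrier} → (∀ i → f i ≈ 1#) → prodF R f ≈ 1#
  prodF-one {zero}  f≈1 = ≈-refl
  prodF-one {suc k} f≈1 = ≈-trans (*-cong (f≈1 Fin.zero) (prodF-one (f≈1 ∘ Fin.suc))) (*-identityˡ 1#)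

  prodF-zero : ∀ {k} (f : Fin k → Carrier) i → f i ≈ 0# → prodF R f ≈ 0#
  prodF-zero f Fin.zero    fi≈0 = ≈-trans (*-congʳ fi≈0) (zeroˡ _)
  prodF-zero f (Fin.suc i) fi≈0 = ≈-trans (*-congˡ (prodF-zero (f ∘ Fin.suc) i fi≈0)) (zeroʳ _)

module _ {c ℓ} (R : CommutativeRing c ℓ) where
  open CommutativeRing R renaming (refl to ≈-refl; sym to ≈-sym; trans to ≈-trans)

  sumF-++ : ∀ {k l} (f : Fin k → Carrier) (g : Fin l → Carrier) → sumF R (f ++ g) ≈ sumF R f + sumF R g
  sumF-++ {zero}  f g = ≈-sym (+-identityˡ _)
  sumF-++ {suc k} f g =
    ≈-trans (+-congˡ (≈-trans (sumF-cong R tail-++) (sumF-++ (f ∘ Fin.suc) g))) (≈-sym (+-assoc _ _ _))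
    where
    tail-++ : ∀ i → (f ++ g) (Fin.suc i) ≈ ((f ∘ Fin.suc) ++ g) i
    tail-++ i with splitAt k i
    ... | inj₁ _ = ≈-refl
    ... | inj₂ _ = ≈-refl

  module _ {a} {I : Set} (A : (I → Carrier) → Set a) where

    inSpan-resp : ∀ {p q} → (∀ x → p x ≈ q x) → InSpan R A q → InSpan R A p
    inSpan-resp p≈q (k , coef , v , v∈A , q≈) = k , coef , v , v∈A , λ x → ≈-trans (p≈q x) (q≈ x)

    inSpan-zero : InSpan R A (λ _ → 0#)
    inSpan-zero = 0 , (λ ()) , (λ ()) , (λ ()) , λ _ → ≈-refl

    member⇒inSpan : ∀ {v} → A v → InSpan R A v
    member⇒inSpan {v} v∈A =
      1 , (λ _ → 1#) , (λ _ → v) , (λ _ → v∈A) , λ x → ≈-sym (≈-trans (+-identityʳ _) (*-identityˡ _))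

    inSpan-+ : ∀ {p q} → InSpan R A p → InSpan R A q → InSpan R A (λ x → p x + q x)
    inSpan-+ (k , c , v , v∈A , p≈) (l , d , w , w∈A , q≈) = k ℕ.+ l , c ++ d , v ++ w , ∈A , λ x →
      ≈-trans (+-cong (p≈ x) (q≈ x))
        (≈-sym (≈-trans (sumF-cong R (term x)) (sumF-++ (λ i → c i * v i x) (λ i → d i * w i x))))
      where
      ∈A : ∀ j → A ((v ++ w) j)
      ∈A j with splitAt k j
      ... | inj₁ i = v∈A i
      ... | inj₂ i = w∈A i
      term : ∀ x j → (c ++ d) j * (v ++ w) j x ≈ ((λ i → c i * v i x) ++ (λ i → d i * w i x)) j
      term x j with splitAt k j
      ... | inj₁ _ = ≈-refl
      ... | inj₂ _ = ≈-refl

    inSpan-scale : ∀ {p} a → InSpan R A p → InSpan R A (λ x → a * p x)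
    inSpan-scale a (k , c , v , v∈A , p≈) = k , (λ j → a * c j) , v , v∈A , λ x →
      ≈-trans (*-congˡ (p≈ x))
        (≈-trans (*-distribˡ-sumF R a (λ j → c j * v j x)) (sumF-cong R λ j → ≈-sym (*-assoc a (c j) (v j x))))

    inSpan-sumF : ∀ {k} (f : Fin k → I → Carrier) → (∀ j → InSpan R A (f j)) →
                  InSpan R A (λ x → sumF R (λ j → f j x))
    inSpan-sumF {zero}  f f∈ = inSpan-zero
    inSpan-sumF {suc k} f f∈ = inSpan-+ (f∈ Fin.zero) (inSpan-sumF (f ∘ Fin.suc) (f∈ ∘ Fin.suc))

    inSpan-sumMaps : ∀ {k m} (f : (Fin k → Fin m) → I → Carrier) → (∀ h → InSpan R A (f h)) →
                     InSpan R A (λ x → sumMaps R (λ h → f h x))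
    inSpan-sumMaps {zero}  f f∈ = f∈ (λ ())
    inSpan-sumMaps {suc k} f f∈ = inSpan-sumF _ (λ i → inSpan-sumMaps (λ h → f (i ∷ h)) (λ h → f∈ (i ∷ h)))

  inSpan-mono : ∀ {a b} {I : Set} (A : (I → Carrier) → Set a) (B : (I → Carrier) → Set b) →
                (∀ {v} → A v → InSpan R B v) → ∀ {p} → InSpan R A p → InSpan R B p
  inSpan-mono A B A⊆⟨B⟩ (k , c , v , v∈A , p≈) =
    inSpan-resp B p≈ (inSpan-sumF B _ λ j → inSpan-scale B (c j) (A⊆⟨B⟩ (v∈A j)))

module _ {c ℓ} (R : CommutativeRing c ℓ) where
  open CommutativeRing R renaming (refl to ≈-refl; sym to ≈-sym; trans to ≈-trans)

  if-true : ∀ {b} {x y : Carrier} → b ≡ true → (if b then x else y) ≈ x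
  if-true refl = ≈-refl

  if-zero : ∀ b {x} → (b ≡ true → x ≈ 0#) → (if b then x else 0#) ≈ 0#
  if-zero true  x≈0 = x≈0 refl
  if-zero false _   = ≈-refl

  unitRows : ∀ {t m} → (Fin t → Fin m) → Fin t → Fin m → Carrier
  unitRows T u j = if ⌊ T u Finₚ.≟ j ⌋ then 1# else 0#

  unitRows-≡ : ∀ {t m} (T : Fin t → Fin m) u {j} → T u ≡ j → unitRows T u j ≈ 1#
  unitRows-≡ T u {j} Tu≡j with T u Finₚ.≟ j
  ... | yes _    = ≈-refl
  ... | no Tu≢j  = contradiction Tu≡j Tu≢j

  unitRows-≢ : ∀ {t m} (T : Fin t → Fin m) u {j} → T u ≢ j → unitRows T u j ≈ 0#
  unitRows-≢ T u {j} Tu≢j with T u Finₚ.≟ j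
  ... | yes Tu≡j = contradiction Tu≡j Tu≢j
  ... | no _     = ≈-refl

  prodF-unitRows-≗ : ∀ {t m} {T π : Fin t → Fin m} → T ≗ π → prodF R (λ u → unitRows T u (π u)) ≈ 1#
  prodF-unitRows-≗ {T = T} T≗π = prodF-one R λ u → unitRows-≡ T u (T≗π u)

  prodF-unitRows-≭ : ∀ {t m} {T π : Fin t → Fin m} → ¬ T ≗ π → prodF R (λ u → unitRows T u (π u)) ≈ 0#
  prodF-unitRows-≭ {t} {T = T} {π} T≭π =
    let u , Tu≢πu = Finₚ.¬∀⟶∃¬ t _ (λ u → T u Finₚ.≟ π u) T≭π
    in prodF-zero R _ u (unitRows-≢ T u Tu≢πu)

  unitRows-sifting : ∀ {k m} (lam : Fin k → Fin m → Carrier) (π₀ : Fin k → Fin m) →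
                     sumMaps R (λ π → prodF R (λ u → lam u (π u)) * prodF R (λ u → unitRows π u (π₀ u))) ≈
                     prodF R (λ u → lam u (π₀ u))
  unitRows-sifting lam π₀ = sumMaps-single R _ π₀ on off
    where
    on : ∀ π → π ≗ π₀ →
         prodF R (λ u → lam u (π u)) * prodF R (λ u → unitRows π u (π₀ u)) ≈ prodF R (λ u → lam u (π₀ u))
    on π π≗π₀ =
      ≈-trans (*-cong (prodF-cong R λ u → reflexive (cong (lam u) (π≗π₀ u))) (prodF-unitRows-≗ π≗π₀)) (*-identityʳ _)
    off : ∀ π → ¬ π ≗ π₀ → prodF R (λ u → lam u (π u)) * prodF R (λ u → unitRows π u (π₀ u)) ≈ 0#
    off π π≭π₀ = ≈-trans (*-congˡ (prodF-unitRows-≭ π≭π₀)) (zeroʳ _)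

  IdentityFactorsThrough : ℕ → ℕ → Set (c ⊔ ℓ)
  IdentityFactorsThrough N s = Σ (Fin N → Fin s → Carrier) λ α → Σ (Fin s → Fin N → Carrier) λ W →
    ∀ a b → sumF R (λ i → α a i * W i b) ≈ unitRows id a b

¬∀⟶¬¬∃¬ : ∀ {N p} {P : Fin N → Set p} → ¬ (∀ a → P a) → ¬ ¬ (∃ λ a → ¬ P a)
¬∀⟶¬¬∃¬ {zero}  ¬∀P _    = ¬∀P λ ()
¬∀⟶¬¬∃¬ {suc N} ¬∀P ¬∃¬P = ¬∃¬P (Fin.zero , λ P₀ →
  ¬∀⟶¬¬∃¬ (λ ∀P → ¬∀P λ { Fin.zero → P₀ ; (Fin.suc a) → ∀P a })
          (λ (a , ¬Pa) → ¬∃¬P (Fin.suc a , ¬Pa)))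

module _ {c ℓ} (R : CommutativeRing c ℓ) (F : IsField R) where
  open CommutativeRing R renaming (refl to ≈-refl; sym to ≈-sym; trans to ≈-trans)
  open IsField F
  open import Algebra.Properties.Ring ring using (-‿distribˡ-*)
  open import Relation.Binary.Reasoning.Setoid setoid

  sumF-row-operation : ∀ {s} (x y w : Fin s → Carrier) a →
    sumF R (λ j → (x j + a * y j) * w j) ≈ sumF R (λ j → x j * w j) + a * sumF R (λ j → y j * w j)
  sumF-row-operation x y w a = begin
    sumF R (λ j → (x j + a * y j) * w j)
      ≈⟨ sumF-cong R (λ j → ≈-trans (distribʳ (w j) (x j) (a * y j)) (+-congˡ (*-assoc a (y j) (w j)))) ⟩
    sumF R (λ j → x j * w j + a * (y j * w j))
      ≈⟨ sumF-distrib-+ R (λ j → x j * w j) (λ j → a * (y j * w j)) ⟩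
    sumF R (λ j → x j * w j) + sumF R (λ j → a * (y j * w j))
      ≈⟨ +-congˡ (*-distribˡ-sumF R a (λ j → y j * w j)) ⟨
    sumF R (λ j → x j * w j) + a * sumF R (λ j → y j * w j) ∎

  identity-punchIn : ∀ {N} (a₀ : Fin (suc N)) a b → unitRows R id (punchIn a₀ a) (punchIn a₀ b) ≈ unitRows R id a b
  identity-punchIn a₀ a b with a Finₚ.≟ b
  ... | yes refl = unitRows-≡ R id (punchIn a₀ a) refl
  ... | no a≢b   = unitRows-≢ R id (punchIn a₀ a) (a≢b ∘ Finₚ.punchIn-injective a₀ a b)

  -- Clearing column 0 with the pivot row a₀ and deleting both leaves a factorisation of the smaller identity.
  eliminate-pivot : ∀ {N s} (α : Fin (suc N) → Fin (suc s) → Carrier) (W : Fin (suc s) → Fin (suc N) → Carrier) →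
                    (∀ a b → sumF R (λ i → α a i * W i b) ≈ unitRows R id a b) →
                    ∀ a₀ → ¬ α a₀ Fin.zero ≈ 0# → IdentityFactorsThrough R N s
  eliminate-pivot α W αW≈I a₀ pivot≉0 =
    (λ a i → row a (Fin.suc i)) , (λ i b → W (Fin.suc i) (punchIn a₀ b)) , reduced
    where
    β : Carrier
    β = proj₁ (inverse _ pivot≉0)
    β∙pivot≈1 : β * α a₀ Fin.zero ≈ 1#
    β∙pivot≈1 = ≈-trans (*-comm _ _) (proj₂ (inverse _ pivot≉0))
    coef : Fin _ → Carrier
    coef a = - (α (punchIn a₀ a) Fin.zero * β)
    row : Fin _ → Fin _ → Carrier
    row a j = α (punchIn a₀ a) j + coef a * α a₀ j
    row-cleared : ∀ a → row a Fin.zero ≈ 0#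
    row-cleared a = begin
      A + - (A * β) * α a₀ Fin.zero   ≈⟨ +-congˡ (-‿distribˡ-* _ _) ⟨
      A + - (A * β * α a₀ Fin.zero)   ≈⟨ +-congˡ (-‿cong (≈-trans (*-assoc _ _ _) (*-congˡ β∙pivot≈1))) ⟩
      A + - (A * 1#)                  ≈⟨ +-congˡ (-‿cong (*-identityʳ A)) ⟩
      A + - A                         ≈⟨ -‿inverseʳ A ⟩
      0#                              ∎
      where A = α (punchIn a₀ a) Fin.zero
    reduced : ∀ a b → sumF R (λ i → row a (Fin.suc i) * W (Fin.suc i) (punchIn a₀ b)) ≈ unitRows R id a b
    reduced a b = begin
      sumF R (λ i → row a (Fin.suc i) * W (Fin.suc i) b′)
        ≈⟨ +-identityˡ _ ⟨
      0# + sumF R (λ i → row a (Fin.suc i) * W (Fin.suc i) b′)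
        ≈⟨ +-congʳ (≈-trans (*-congʳ (row-cleared a)) (zeroˡ _)) ⟨
      sumF R (λ j → row a j * W j b′)
        ≈⟨ sumF-row-operation (α (punchIn a₀ a)) (α a₀) (λ j → W j b′) (coef a) ⟩
      sumF R (λ j → α (punchIn a₀ a) j * W j b′) + coef a * sumF R (λ j → α a₀ j * W j b′)
        ≈⟨ +-cong (αW≈I _ b′) (*-congˡ (αW≈I a₀ b′)) ⟩
      unitRows R id (punchIn a₀ a) b′ + coef a * unitRows R id a₀ b′
        ≈⟨ +-congˡ (≈-trans (*-congˡ (unitRows-≢ R id a₀ (Finₚ.punchInᵢ≢i a₀ b ∘ ≡.sym))) (zeroʳ _)) ⟩
      unitRows R id (punchIn a₀ a) b′ + 0#
        ≈⟨ +-identityʳ _ ⟩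
      unitRows R id (punchIn a₀ a) b′
        ≈⟨ identity-punchIn a₀ a b ⟩
      unitRows R id a b ∎
      where b′ = punchIn a₀ b

  identity-factors⇒≤ : ∀ {N s} → IdentityFactorsThrough R N s → N ≤ s
  identity-factors⇒≤ {zero}          _             = z≤n
  identity-factors⇒≤ {suc N} {zero}  (α , W , αW≈I) =
    ⊥-elim (0≉1 (≈-trans (αW≈I Fin.zero Fin.zero) (unitRows-≡ R {suc N} id Fin.zero refl)))
  -- Column 0 either vanishes and is dropped, or has a pivot; as N ≤ s is decidable we may argue classically.
  identity-factors⇒≤ {suc N} {suc s} (α , W , αW≈I) = s≤s (decidable-stable (N ℕ.≤? s) λ N≰s →
    ¬∀⟶¬¬∃¬ (λ column₀≈0 → N≰s (ℕₚ.<⇒≤ (identity-factors⇒≤ (drop-column₀ column₀≈0))))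
            (λ (a₀ , pivot≉0) → N≰s (identity-factors⇒≤ (eliminate-pivot α W αW≈I a₀ pivot≉0))))
    where
    drop-column₀ : (∀ a → α a Fin.zero ≈ 0#) → IdentityFactorsThrough R (suc N) s
    drop-column₀ column₀≈0 = (λ a → α a ∘ Fin.suc) , (λ i → W (Fin.suc i)) , λ a b →
      ≈-trans (≈-sym (≈-trans (+-congʳ (≈-trans (*-congʳ (column₀≈0 a)) (zeroˡ _))) (+-identityˡ _))) (αW≈I a b)

allB-sound : ∀ {k} {f : Fin k → Bool} → allB f ≡ true → ∀ i → f i ≡ true
allB-sound {suc k} {f} p i with f Fin.zero in f₀
allB-sound {suc k} p Fin.zero    | true = f₀
allB-sound {suc k} p (Fin.suc i) | true = allB-sound p i

allB-complete : ∀ {k} {f : Fin k → Bool} → (∀ i → f i ≡ true) → allB f ≡ true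
allB-complete {zero}      p = refl
allB-complete {suc k} {f} p rewrite p Fin.zero = allB-complete (p ∘ Fin.suc)

allB-false : ∀ {k} {f : Fin k → Bool} → allB f ≡ false → ∃ λ i → f i ≡ false
allB-false {suc k} {f} p with f Fin.zero in f₀
... | false = Fin.zero , f₀
... | true  = let i , fi = allB-false p in Fin.suc i , fi

isInj-sound : ∀ {k m} (σ : Fin k → Fin m) → isInj σ ≡ true → Injective _≡_ _≡_ σ
isInj-sound σ p {i} {j} σi≡σj with allB-sound (allB-sound p i) j
... | entry with i Finₚ.≟ j
...   | yes i≡j = i≡j
...   | no _ with σ i Finₚ.≟ σ j
...     | yes _    = contradiction entry λ ()
...     | no σi≢σj = contradiction σi≡σj σi≢σj

-- The explicit {k} keeps the entries β-normal, so that the with-abstractions below reach them.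
isInj-false : ∀ {k m} (σ : Fin k → Fin m) → isInj σ ≡ false → ¬ Injective _≡_ _≡_ σ
isInj-false {k} σ p inj with allB-false {k} p
... | i , row with allB-false {k} row
...   | j , entry with i Finₚ.≟ j
...     | yes _   = contradiction entry λ ()
...     | no i≢j with σ i Finₚ.≟ σ j
...       | yes σi≡σj = contradiction (inj σi≡σj) i≢j
...       | no _      = contradiction entry λ ()

isInj-complete : ∀ {k m} (σ : Fin k → Fin m) → Injective _≡_ _≡_ σ → isInj σ ≡ true
isInj-complete σ inj with isInj σ in eq
... | true  = refl
... | false = ⊥-elim (isInj-false σ eq inj)

exponentOf : ∀ {r m} → (Fin r → Fin m) → Fin r → Fin m → ℕ
exponentOf ρ u i = if ⌊ ρ u Finₚ.≟ i ⌋ then 1 else 0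

exponentOf-on : ∀ {r m} (ρ : Fin r → Fin m) u → exponentOf ρ u (ρ u) ≡ 1
exponentOf-on ρ u with ρ u Finₚ.≟ ρ u
... | yes _  = refl
... | no ≢ρu = contradiction refl ≢ρu

exponentOf-off : ∀ {r m} (ρ : Fin r → Fin m) u i → ρ u ≢ i → exponentOf ρ u i ≡ 0
exponentOf-off ρ u i ρu≢i with ρ u Finₚ.≟ i
... | yes ρu≡i = contradiction ρu≡i ρu≢i
... | no _     = refl

isMonoOf-sound : ∀ {r m} (ρ : Fin r → Fin m) e → isMonoOf ρ e ≡ true → ∀ u i → e u i ≡ exponentOf ρ u i
isMonoOf-sound {r} {m} ρ e p u i with allB-sound {m} (allB-sound {r} p u) i
... | entry with e u i ℕ.≟ exponentOf ρ u i
...   | yes eq = eq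
...   | no _   = contradiction entry λ ()

isMonoOf-complete : ∀ {r m} (ρ : Fin r → Fin m) e → (∀ u i → e u i ≡ exponentOf ρ u i) → isMonoOf ρ e ≡ true
isMonoOf-complete ρ e e≡ = allB-complete λ u → allB-complete λ i → entry u i
  where
  entry : ∀ u i → ⌊ e u i ℕ.≟ exponentOf ρ u i ⌋ ≡ true
  entry u i with e u i ℕ.≟ exponentOf ρ u i
  ... | yes _ = refl
  ... | no ≢  = contradiction (e≡ u i) ≢

isMonoOf-unique : ∀ {r m} {ρ ρ′ : Fin r → Fin m} e → isMonoOf ρ e ≡ true → isMonoOf ρ′ e ≡ true → ρ ≗ ρ′
isMonoOf-unique {ρ = ρ} {ρ′} e p p′ u with ρ u Finₚ.≟ ρ′ u
... | yes ρu≡ρ′u = ρu≡ρ′u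
... | no ρu≢ρ′u  = contradiction exponents-agree λ ()
  where
  exponents-agree : 1 ≡ 0
  exponents-agree = begin
    1                      ≡⟨ exponentOf-on ρ u ⟨
    exponentOf ρ u (ρ u)   ≡⟨ isMonoOf-sound ρ e p u (ρ u) ⟨
    e u (ρ u)              ≡⟨ isMonoOf-sound ρ′ e p′ u (ρ u) ⟩
    exponentOf ρ′ u (ρ u)  ≡⟨ exponentOf-off ρ′ u (ρ u) (ρu≢ρ′u ∘ ≡.sym) ⟩
    0                      ∎
    where open ≡.≡-Reasoning

isMonoOf-resp-≗ : ∀ {r m} {ρ ρ′ : Fin r → Fin m} e → ρ ≗ ρ′ → isMonoOf ρ e ≡ true → isMonoOf ρ′ e ≡ true
isMonoOf-resp-≗ {ρ = ρ} {ρ′} e ρ≗ρ′ p = isMonoOf-complete ρ′ e λ u i →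
  ≡.trans (isMonoOf-sound ρ e p u i) (cong (λ j → if ⌊ j Finₚ.≟ i ⌋ then 1 else 0) (ρ≗ρ′ u))

sumℕ-cong : ∀ {k} {f g : Fin k → ℕ} → f ≗ g → sumℕ f ≡ sumℕ g
sumℕ-cong {zero}  f≗g = refl
sumℕ-cong {suc k} f≗g = ≡.cong₂ ℕ._+_ (f≗g Fin.zero) (sumℕ-cong (f≗g ∘ Fin.suc))

sumℕ-zero : ∀ {k} {f : Fin k → ℕ} → (∀ i → f i ≡ 0) → sumℕ f ≡ 0
sumℕ-zero {zero}  f≡0 = refl
sumℕ-zero {suc k} f≡0 rewrite f≡0 Fin.zero = sumℕ-zero (f≡0 ∘ Fin.suc)

sumℕ-single : ∀ {k} (f : Fin k → ℕ) i₀ → (∀ i → i ≢ i₀ → f i ≡ 0) → sumℕ f ≡ f i₀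
sumℕ-single f Fin.zero     f≡0 rewrite sumℕ-zero (λ i → f≡0 (Fin.suc i) λ ()) = ℕₚ.+-identityʳ _
sumℕ-single f (Fin.suc i₀) f≡0 rewrite f≡0 Fin.zero (λ ()) =
  sumℕ-single (f ∘ Fin.suc) i₀ (λ i i≢i₀ → f≡0 (Fin.suc i) (i≢i₀ ∘ Finₚ.suc-injective))

sumℕ-one : ∀ k → sumℕ {k} (λ _ → 1) ≡ k
sumℕ-one zero    = refl
sumℕ-one (suc k) = cong suc (sumℕ-one k)

monomial : ∀ {r m} → (Fin r → Fin m) → Mono r m r
monomial {r} ρ = exponentOf ρ , ≡.trans (sumℕ-cong row-degree) (sumℕ-one r)
  where
  row-degree : ∀ u → sumℕ (exponentOf ρ u) ≡ 1
  row-degree u = ≡.trans (sumℕ-single (exponentOf ρ u) (ρ u) (λ i i≢ρu → exponentOf-off ρ u i (i≢ρu ∘ ≡.sym)))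
                         (exponentOf-on ρ u)

isMonoOf-monomial : ∀ {r m} (ρ : Fin r → Fin m) → isMonoOf ρ (proj₁ (monomial ρ)) ≡ true
isMonoOf-monomial ρ = isMonoOf-complete ρ (exponentOf ρ) (λ _ _ → refl)

any-map? : ∀ {k m} (Q : (Fin k → Fin m) → Bool) → (∀ {h h′} → h ≗ h′ → Q h ≡ true → Q h′ ≡ true) →
           Dec (∃ λ h → Q h ≡ true)
any-map? {zero} Q Q-resp with Q (λ ()) in Q[]
... | true  = yes (_ , Q[])
... | false = no λ (h , Qh) → contradiction (≡.trans (≡.sym (Q-resp (λ ()) Qh)) Q[]) λ ()
any-map? {suc k} Q Q-resp
  with Finₚ.any? (λ i → any-map? (Q ∘ (i ∷_)) (Q-resp ∘ ∷-cong refl))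
... | yes (i , h , Qh) = yes (i ∷ h , Qh)
... | no ∄             = no λ (h , Qh) → ∄ (h Fin.zero , h ∘ Fin.suc , Q-resp (∷-cong refl (λ _ → refl)) Qh)

increasing⇒injective : ∀ {k m} {g : Fin k → Fin m} → StrictlyIncreasing g → Injective _≡_ _≡_ g
increasing⇒injective {g = g} incr {i} {j} gi≡gj with Finₚ.<-cmp i j
... | tri< i<j _ _ = contradiction gi≡gj (Finₚ.<⇒≢ (incr i j i<j))
... | tri≈ _ i≡j _ = i≡j
... | tri> _ _ j<i = contradiction (≡.sym gi≡gj) (Finₚ.<⇒≢ (incr j i j<i))

injective-resp-≗ : ∀ {k m} {σ σ′ : Fin k → Fin m} → σ ≗ σ′ → Injective _≡_ _≡_ σ → Injective _≡_ _≡_ σ′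
injective-resp-≗ σ≗σ′ σ-inj {i} {j} eq = σ-inj (≡.trans (σ≗σ′ i) (≡.trans eq (≡.sym (σ≗σ′ j))))

increasing-suc : ∀ {k m} {g : Fin k → Fin m} → StrictlyIncreasing g → StrictlyIncreasing (Fin.suc ∘ g)
increasing-suc incr i j i<j = s≤s (incr i j i<j)

increasing-zero∷suc : ∀ {k m} {g : Fin k → Fin m} → StrictlyIncreasing g →
                      StrictlyIncreasing {suc k} (Fin.zero ∷ Fin.suc ∘ g)
increasing-zero∷suc incr Fin.zero    (Fin.suc j) _         = s≤s z≤n
increasing-zero∷suc incr (Fin.suc i) (Fin.suc j) (s≤s i<j) = s≤s (incr i j i<j)

record Complementary {k r m} (g : Fin k → Fin m) (f : Fin r → Fin m) : Set where
  field
    injectiveˡ : Injective _≡_ _≡_ g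
    injectiveʳ : Injective _≡_ _≡_ f
    disjoint   : ∀ u v → g u ≢ f v
    covering   : ∀ j → (∃ λ u → g u ≡ j) ⊎ (∃ λ v → f v ≡ j)

complementary-sym : ∀ {k r m} {g : Fin k → Fin m} {f : Fin r → Fin m} → Complementary g f → Complementary f g
complementary-sym C = record
  { injectiveˡ = injectiveʳ
  ; injectiveʳ = injectiveˡ
  ; disjoint   = λ v u fv≡gu → disjoint u v (≡.sym fv≡gu)
  ; covering   = Sum.swap ∘ covering
  }
  where open Complementary C

complementary-zero∷suc : ∀ {k r m} {g : Fin k → Fin m} {f : Fin r → Fin (suc m)} {f′ : Fin r → Fin m} →
                         Injective _≡_ _≡_ f → f ≗ Fin.suc ∘ f′ →
                         StrictlyIncreasing g → Complementary g f′ → Complementary {suc k} (Fin.zero ∷ Fin.suc ∘ g) f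
complementary-zero∷suc {f′ = f′} f-inj f≗suc∘f′ incr C = record
  { injectiveˡ = increasing⇒injective (increasing-zero∷suc incr)
  ; injectiveʳ = f-inj
  ; disjoint   = λ { Fin.zero v 0≡fv → contradiction (≡.trans 0≡fv (f≗suc∘f′ v)) λ ()
                   ; (Fin.suc u) v gu≡fv → disjoint u v (Finₚ.suc-injective (≡.trans gu≡fv (f≗suc∘f′ v))) }
  ; covering   = λ { Fin.zero → inj₁ (Fin.zero , refl)
                   ; (Fin.suc j) → Sum.map (λ (u , gu≡j) → Fin.suc u , cong Fin.suc gu≡j)
                                           (λ (v , f′v≡j) → v , ≡.trans (f≗suc∘f′ v) (cong Fin.suc f′v≡j))
                                           (covering j) }
  }
  where open Complementary C

complementary-suc : ∀ {k r m} {g : Fin k → Fin m} {f : Fin (suc r) → Fin (suc m)} {f′ : Fin r → Fin m} →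
                    Injective _≡_ _≡_ f → ∀ v₀ → f v₀ ≡ Fin.zero → f ∘ punchIn v₀ ≗ Fin.suc ∘ f′ →
                    StrictlyIncreasing g → Complementary g f′ → Complementary (Fin.suc ∘ g) f
complementary-suc {g = g} {f} {f′} f-inj v₀ fv₀≡0 f∘punchIn≗suc∘f′ incr C = record
  { injectiveˡ = increasing⇒injective (increasing-suc incr)
  ; injectiveʳ = f-inj
  ; disjoint   = disjoint′
  ; covering   = λ { Fin.zero → inj₂ (v₀ , fv₀≡0)
                   ; (Fin.suc j) → Sum.map (λ (u , gu≡j) → u , cong Fin.suc gu≡j)
                                           (λ (w , f′w≡j) → punchIn v₀ w ,
                                                            ≡.trans (f∘punchIn≗suc∘f′ w) (cong Fin.suc f′w≡j))
                                           (covering j) }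
  }
  where
  open Complementary C
  disjoint′ : ∀ u v → Fin.suc (g u) ≢ f v
  disjoint′ u v sgu≡fv with v Finₚ.≟ v₀
  ... | yes refl = contradiction (≡.trans sgu≡fv fv₀≡0) λ ()
  ... | no v≢v₀  = disjoint u w (Finₚ.suc-injective (begin
    Fin.suc (g u)         ≡⟨ sgu≡fv ⟩
    f v                   ≡⟨ cong f (Finₚ.punchIn-punchOut v₀≢v) ⟨
    f (punchIn v₀ w)      ≡⟨ f∘punchIn≗suc∘f′ w ⟩
    Fin.suc (f′ w)        ∎))
    where
    open ≡.≡-Reasoning
    v₀≢v = v≢v₀ ∘ ≡.sym
    w = punchOut v₀≢v

complement : ∀ m {r} (f : Fin r → Fin m) → Injective _≡_ _≡_ f →
             ∃ λ k → k ℕ.+ r ≡ m × Σ (Fin k → Fin m) λ g → StrictlyIncreasing g × Complementary g f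
complement zero {zero} f f-inj =
  0 , refl , (λ ()) , (λ ()) , record { injectiveˡ = λ {} ; injectiveʳ = f-inj ; disjoint = λ () ; covering = λ () }
complement zero {suc r} f f-inj with f Fin.zero
... | ()
complement (suc m) {r} f f-inj with Finₚ.any? (λ v → f v Finₚ.≟ Fin.zero)
... | no 0∉f =
  let k , k+r≡m , g , incr , C = complement m f′ f′-inj
  in suc k , cong suc k+r≡m , _ , increasing-zero∷suc incr , complementary-zero∷suc f-inj f≗suc∘f′ incr C
  where
  f′ : Fin r → Fin m
  f′ v = punchOut {i = Fin.zero} λ 0≡fv → 0∉f (v , ≡.sym 0≡fv)
  f≗suc∘f′ : f ≗ Fin.suc ∘ f′
  f≗suc∘f′ v = ≡.sym (Finₚ.punchIn-punchOut {i = Fin.zero} _)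
  f′-inj : Injective _≡_ _≡_ f′
  f′-inj f′v≡f′w = f-inj (≡.trans (f≗suc∘f′ _) (≡.trans (cong Fin.suc f′v≡f′w) (≡.sym (f≗suc∘f′ _))))
... | yes (v₀ , fv₀≡0) = zero∈image f f-inj v₀ fv₀≡0
  where
  zero∈image : ∀ {r} (f : Fin r → Fin (suc m)) → Injective _≡_ _≡_ f → ∀ v₀ → f v₀ ≡ Fin.zero →
               ∃ λ k → k ℕ.+ r ≡ suc m × Σ (Fin k → Fin (suc m)) λ g → StrictlyIncreasing g × Complementary g f
  zero∈image {suc r} f f-inj v₀ fv₀≡0 =
    let k , k+r≡m , g , incr , C = complement m f′ f′-inj
    in k , ≡.trans (ℕₚ.+-suc k r) (cong suc k+r≡m) , _ , increasing-suc incr ,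
       complementary-suc f-inj v₀ fv₀≡0 f∘punchIn≗suc∘f′ incr C
    where
    f′ : Fin r → Fin m
    f′ w = punchOut {i = Fin.zero} λ 0≡f →
      Finₚ.punchInᵢ≢i v₀ w (f-inj (≡.trans (≡.sym 0≡f) (≡.sym fv₀≡0)))
    f∘punchIn≗suc∘f′ : f ∘ punchIn v₀ ≗ Fin.suc ∘ f′
    f∘punchIn≗suc∘f′ w = ≡.sym (Finₚ.punchIn-punchOut {i = Fin.zero} _)
    f′-inj : Injective _≡_ _≡_ f′
    f′-inj {v} {w} f′v≡f′w = Finₚ.punchIn-injective v₀ v w (f-inj (begin
      f (punchIn v₀ v)   ≡⟨ f∘punchIn≗suc∘f′ v ⟩
      Fin.suc (f′ v)     ≡⟨ cong Fin.suc f′v≡f′w ⟩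
      Fin.suc (f′ w)     ≡⟨ f∘punchIn≗suc∘f′ w ⟨
      f (punchIn v₀ w)   ∎))
      where open ≡.≡-Reasoning

complement-of-size : ∀ {k r m} → k ℕ.+ r ≡ m → (f : Fin r → Fin m) → Injective _≡_ _≡_ f →
                     Σ (Fin k → Fin m) λ g → StrictlyIncreasing g × Complementary g f
complement-of-size {k} {r} {m} k+r≡m f f-inj with complement m f f-inj
... | k′ , k′+r≡m , g , incr , C with ℕₚ.+-cancelʳ-≡ r k′ k (≡.trans k′+r≡m (≡.sym k+r≡m))
...   | refl = g , incr , C

↑ˡ≢↑ʳ : ∀ {t r} (u : Fin t) (v : Fin r) → u ↑ˡ r ≢ t ↑ʳ v
↑ˡ≢↑ʳ {t} {r} u v eq
  with ≡.trans (≡.sym (Finₚ.splitAt-↑ˡ t u r)) (≡.trans (cong (splitAt t) eq) (Finₚ.splitAt-↑ʳ t r v))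
... | ()

module _ {t r m} {T : Fin t → Fin m} {ρ : Fin r → Fin m} where

  ++-injective : Injective _≡_ _≡_ T → Injective _≡_ _≡_ ρ → (∀ u v → T u ≢ ρ v) → Injective _≡_ _≡_ (T ++ ρ)
  ++-injective T-inj ρ-inj T∩ρ=∅ {i} {j} eq with splitAt t i in split-i | splitAt t j in split-j
  ... | inj₁ u | inj₁ v = ≡.trans (≡.sym (Finₚ.splitAt⁻¹-↑ˡ split-i))
                            (≡.trans (cong (_↑ˡ r) (T-inj eq)) (Finₚ.splitAt⁻¹-↑ˡ split-j))
  ... | inj₁ u | inj₂ v = contradiction eq (T∩ρ=∅ u v)
  ... | inj₂ u | inj₁ v = contradiction (≡.sym eq) (T∩ρ=∅ v u)
  ... | inj₂ u | inj₂ v = ≡.trans (≡.sym (Finₚ.splitAt⁻¹-↑ʳ split-i))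
                            (≡.trans (cong (t ↑ʳ_) (ρ-inj eq)) (Finₚ.splitAt⁻¹-↑ʳ split-j))

  module _ (T++ρ-inj : Injective _≡_ _≡_ (T ++ ρ)) where

    ++-injectiveˡ : Injective _≡_ _≡_ T
    ++-injectiveˡ {u} {v} Tu≡Tv = Finₚ.↑ˡ-injective r u v
      (T++ρ-inj (≡.trans (lookup-++ˡ T ρ u) (≡.trans Tu≡Tv (≡.sym (lookup-++ˡ T ρ v)))))

    ++-injectiveʳ : Injective _≡_ _≡_ ρ
    ++-injectiveʳ {u} {v} ρu≡ρv = Finₚ.↑ʳ-injective t u v
      (T++ρ-inj (≡.trans (lookup-++ʳ T ρ u) (≡.trans ρu≡ρv (≡.sym (lookup-++ʳ T ρ v)))))

    ++-disjoint : ∀ u v → T u ≢ ρ v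
    ++-disjoint u v Tu≡ρv = ↑ˡ≢↑ʳ u v
      (T++ρ-inj (≡.trans (lookup-++ˡ T ρ u) (≡.trans Tu≡ρv (≡.sym (lookup-++ʳ T ρ v)))))

  ++-unique : ∀ (σ : Fin (t ℕ.+ r) → Fin m) → σ ∘ (_↑ˡ r) ≗ T → σ ∘ (t ↑ʳ_) ≗ ρ → σ ≗ T ++ ρ
  ++-unique σ σˡ≗T σʳ≗ρ i with splitAt t i in split-i
  ... | inj₁ u = ≡.trans (cong σ (≡.sym (Finₚ.splitAt⁻¹-↑ˡ split-i))) (σˡ≗T u)
  ... | inj₂ u = ≡.trans (cong σ (≡.sym (Finₚ.splitAt⁻¹-↑ʳ split-i))) (σʳ≗ρ u)


escapes-image : ∀ {r m} (f : Fin r → Fin m) (g : Fin (suc r) → Fin m) → Injective _≡_ _≡_ g →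
                ∃ λ v → ∀ u → f u ≢ g v
escapes-image {r} f g g-inj with Finₚ.any? (λ v → Finₚ.all? (λ u → ¬? (f u Finₚ.≟ g v)))
... | yes escape = escape
... | no ∄escape = contradiction (Finₚ.injective⇒≤ preimage-inj) ℕₚ.1+n≰n
  where
  hit : ∀ v → ∃ λ u → f u ≡ g v
  hit v = let u , ¬f≢g = Finₚ.¬∀⟶∃¬ r _ (λ u → ¬? (f u Finₚ.≟ g v)) (λ ∀≢ → ∄escape (v , ∀≢))
          in u , decidable-stable (f u Finₚ.≟ g v) ¬f≢g
  preimage-inj : Injective _≡_ _≡_ (proj₁ ∘ hit)
  preimage-inj {v} {w} eq = g-inj (≡.trans (≡.sym (proj₂ (hit v))) (≡.trans (cong f eq) (proj₂ (hit w))))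

pascal-split : ∀ n r → Fin (suc n C suc r) → Fin (n C r) ⊎ Fin (n C suc r)
pascal-split n r = splitAt (n C r) ∘ cast (≡.sym (nCk+nC[k+1]≡[n+1]C[k+1] n r))

pascal-split-injective : ∀ n r → Injective _≡_ _≡_ (pascal-split n r)
pascal-split-injective n r {i} {j} eq =
  ≡.trans (≡.sym (unsplit-split i)) (≡.trans (cong unsplit eq) (unsplit-split j))
  where
  pascal : n C r ℕ.+ n C suc r ≡ suc n C suc r
  pascal = nCk+nC[k+1]≡[n+1]C[k+1] n r
  unsplit : Fin (n C r) ⊎ Fin (n C suc r) → Fin (suc n C suc r)
  unsplit = cast pascal ∘ Fin.join (n C r) (n C suc r)
  unsplit-split : ∀ i → unsplit (pascal-split n r i) ≡ i
  unsplit-split i =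
    ≡.trans (cong (cast pascal) (Finₚ.join-splitAt (n C r) (n C suc r) _)) (Finₚ.cast-involutive pascal _ i)

-- The r-subsets of Fin n in increasing enumeration; by Pascal's rule, those containing 0 come first.
mutual
  combination : ∀ n r → Fin (n C r) → Fin r → Fin n
  combination n       zero    _ ()
  combination zero    (suc r) ()
  combination (suc n) (suc r) i = combination-pascal n r (pascal-split n r i)

  combination-pascal : ∀ n r → Fin (n C r) ⊎ Fin (n C suc r) → Fin (suc r) → Fin (suc n)
  combination-pascal n r (inj₁ a) = Fin.zero ∷ Fin.suc ∘ combination n r a
  combination-pascal n r (inj₂ b) = Fin.suc ∘ combination n (suc r) b

combination-increasing : ∀ n r i → StrictlyIncreasing (combination n r i)
combination-increasing n       zero    _ ()
combination-increasing zero    (suc r) ()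
combination-increasing (suc n) (suc r) i with pascal-split n r i
... | inj₁ a = increasing-zero∷suc (combination-increasing n r a)
... | inj₂ b = increasing-suc (combination-increasing n (suc r) b)

mutual
  combination-separates : ∀ n r {i j} → i ≢ j → ∃ λ v → ∀ u → combination n r i u ≢ combination n r j v
  combination-separates n       zero    {Fin.zero} {Fin.zero} i≢j = contradiction refl i≢j
  combination-separates (suc n) (suc r) i≢j =
    combination-pascal-separates n r (i≢j ∘ pascal-split-injective n r)

  combination-pascal-separates : ∀ n r {x y} → x ≢ y →
    ∃ λ v → ∀ u → combination-pascal n r x u ≢ combination-pascal n r y v
  combination-pascal-separates n r {inj₁ a} {inj₁ b} x≢y =
    let v , a∌bv = combination-separates n r (x≢y ∘ cong inj₁)
    in Fin.suc v , λ { Fin.zero () ; (Fin.suc u) → a∌bv u ∘ Finₚ.suc-injective }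
  combination-pascal-separates n r {inj₂ a} {inj₂ b} x≢y =
    let v , a∌bv = combination-separates n (suc r) (x≢y ∘ cong inj₂)
    in v , λ u → a∌bv u ∘ Finₚ.suc-injective
  combination-pascal-separates n r {inj₂ a} {inj₁ b} _ = Fin.zero , λ u ()
  combination-pascal-separates n r {inj₁ a} {inj₂ b} _ =
    let v , a∌bv = escapes-image (combination n r a) (combination n (suc r) b)
                                 (increasing⇒injective (combination-increasing n (suc r) b))
    in v , λ { Fin.zero () ; (Fin.suc u) → a∌bv u ∘ Finₚ.suc-injective }

some-combination : ∀ {n r} → r ≤ n → Fin (n C r)
some-combination {r = zero}      _         = Fin.zero
some-combination {suc n} {suc r} (s≤s r≤n) =
  cast (nCk+nC[k+1]≡[n+1]C[k+1] n r) (some-combination r≤n ↑ˡ (n C suc r))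

Completes : ∀ {t r} → (Fin t → Fin (t ℕ.+ r)) → (Fin r → Fin (t ℕ.+ r) → ℕ) → Set
Completes T e = ∃ λ ρ → isMonoOf ρ e ≡ true × Injective _≡_ _≡_ (T ++ ρ)

completes? : ∀ {t r} (T : Fin t → Fin (t ℕ.+ r)) e → Dec (Completes T e)
completes? T e with any-map? (λ ρ → isMonoOf ρ e) (isMonoOf-resp-≗ e)
... | no ∄ρ = no λ (ρ , mono , _) → ∄ρ (ρ , mono)
... | yes (ρ , mono) with isInj (T ++ ρ) in inj?
...   | true  = yes (ρ , mono , isInj-sound (T ++ ρ) inj?)
...   | false = no λ (ρ′ , mono′ , inj) →
  isInj-false (T ++ ρ) inj? (injective-resp-≗ (++-cong T T (λ _ → refl) (isMonoOf-unique e mono′ mono)) inj)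

module _ {c ℓ} (R : CommutativeRing c ℓ) {t r : ℕ} where
  open CommutativeRing R renaming (refl to ≈-refl; sym to ≈-sym; trans to ≈-trans)
  open import Algebra.Properties.CommutativeSemigroup *-commutativeSemigroup using (x∙yz≈y∙xz)
  open import Relation.Binary.Reasoning.Setoid setoid

  -- The summands of perSpec and perSub: both unfold definitionally to sumMaps of these.
  perSpecTerm : (Fin t → Fin (t ℕ.+ r) → Carrier) → (Fin r → Fin (t ℕ.+ r) → ℕ) →
                (Fin (t ℕ.+ r) → Fin (t ℕ.+ r)) → Carrier
  perSpecTerm lam e σ =
    if isInj σ then (if isMonoOf (σ ∘ (t ↑ʳ_)) e then prodF R (λ u → lam u (σ (u ↑ˡ r))) else 0#) else 0#

  perSubTerm : (Fin r → Fin (t ℕ.+ r)) → (Fin r → Fin (t ℕ.+ r) → ℕ) → (Fin r → Fin r) → Carrier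
  perSubTerm col e τ = if isInj τ then (if isMonoOf (col ∘ τ) e then 1# else 0#) else 0#

  perSpec-unitRows-zero : ∀ T (x : Mono r (t ℕ.+ r) r) → ¬ Completes T (proj₁ x) →
                          perSpec R t r (unitRows R T) x ≈ 0#
  perSpec-unitRows-zero T (e , _) ¬T⊂e = sumMaps-zero R λ σ →
    if-zero R (isInj σ) λ σ-inj → if-zero R (isMonoOf (σ ∘ (t ↑ʳ_)) e) λ mono → prodF-unitRows-≭ R λ T≗σˡ →
    ¬T⊂e (σ ∘ (t ↑ʳ_) , mono ,
          injective-resp-≗ (++-unique {T = T} σ (≡.sym ∘ T≗σˡ) (λ _ → refl)) (isInj-sound σ σ-inj))

  perSpec-unitRows-one : ∀ T (x : Mono r (t ℕ.+ r) r) → Completes T (proj₁ x) →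
                         perSpec R t r (unitRows R T) x ≈ 1#
  perSpec-unitRows-one T (e , _) (ρ , mono , inj) = sumMaps-single R (perSpecTerm (unitRows R T) e) (T ++ ρ) on off
    where
    on : ∀ σ → σ ≗ T ++ ρ → perSpecTerm (unitRows R T) e σ ≈ 1#
    on σ σ≗T++ρ = ≈-trans (if-true R (isInj-complete σ (injective-resp-≗ (≡.sym ∘ σ≗T++ρ) inj)))
      (≈-trans (if-true R (isMonoOf-resp-≗ e (λ u → ≡.sym (≡.trans (σ≗T++ρ (t ↑ʳ u)) (lookup-++ʳ T ρ u))) mono))
        (prodF-unitRows-≗ R λ u → ≡.sym (≡.trans (σ≗T++ρ (u ↑ˡ r)) (lookup-++ˡ T ρ u))))
    off : ∀ σ → ¬ σ ≗ T ++ ρ → perSpecTerm (unitRows R T) e σ ≈ 0#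
    off σ σ≭T++ρ = if-zero R (isInj σ) λ _ → if-zero R (isMonoOf (σ ∘ (t ↑ʳ_)) e) λ mono′ →
      prodF-unitRows-≭ R λ T≗σˡ → σ≭T++ρ (++-unique {T = T} σ (≡.sym ∘ T≗σˡ) (isMonoOf-unique e mono′ mono))

  module _ {T : Fin t → Fin (t ℕ.+ r)} {col : Fin r → Fin (t ℕ.+ r)} (C : Complementary T col) where
    open Complementary C

    perSub-zero : ∀ (x : Mono r (t ℕ.+ r) r) → ¬ Completes T (proj₁ x) → perSub R r (t ℕ.+ r) col x ≈ 0#
    perSub-zero (e , _) ¬T⊂e = sumMaps-zero R λ τ →
      if-zero R (isInj τ) λ τ-inj → if-zero R (isMonoOf (col ∘ τ) e) λ mono →
      ⊥-elim (¬T⊂e (col ∘ τ , mono ,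
                    ++-injective injectiveˡ (isInj-sound τ τ-inj ∘ injectiveʳ) (λ u v → disjoint u (τ v))))

    perSub-one : ∀ (x : Mono r (t ℕ.+ r) r) → Completes T (proj₁ x) → perSub R r (t ℕ.+ r) col x ≈ 1#
    perSub-one (e , _) (ρ , mono , inj) = sumMaps-single R (perSubTerm col e) τ₀ on off
      where
      preimage : ∀ u → ∃ λ v → col v ≡ ρ u
      preimage u = Sum.[ (λ (w , Tw≡ρu) → contradiction Tw≡ρu (++-disjoint inj w u)) , id ] (covering (ρ u))
      τ₀ : Fin r → Fin r
      τ₀ = proj₁ ∘ preimage
      on : ∀ τ → τ ≗ τ₀ → perSubTerm col e τ ≈ 1#
      on τ τ≗τ₀ = ≈-trans (if-true R (isInj-complete τ (injective-resp-≗ (≡.sym ∘ τ≗τ₀) τ₀-inj)))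
                          (if-true R (isMonoOf-resp-≗ e (≡.sym ∘ col∘τ≗ρ) mono))
        where
        col∘τ≗ρ : col ∘ τ ≗ ρ
        col∘τ≗ρ u = ≡.trans (cong col (τ≗τ₀ u)) (proj₂ (preimage u))
        τ₀-inj : Injective _≡_ _≡_ τ₀
        τ₀-inj eq =
          ++-injectiveʳ inj (≡.trans (≡.sym (proj₂ (preimage _))) (≡.trans (cong col eq) (proj₂ (preimage _))))
      off : ∀ τ → ¬ τ ≗ τ₀ → perSubTerm col e τ ≈ 0#
      off τ τ≭τ₀ = if-zero R (isInj τ) λ _ → if-zero R (isMonoOf (col ∘ τ) e) λ mono′ →
        ⊥-elim (τ≭τ₀ λ u → injectiveʳ (≡.trans (isMonoOf-unique e mono′ mono u) (≡.sym (proj₂ (preimage u)))))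

    perSub≈perSpec-unitRows : ∀ x → perSub R r (t ℕ.+ r) col x ≈ perSpec R t r (unitRows R T) x
    perSub≈perSpec-unitRows x with completes? T (proj₁ x)
    ... | yes T⊂x = ≈-trans (perSub-one x T⊂x) (≈-sym (perSpec-unitRows-one T x T⊂x))
    ... | no ¬T⊂x = ≈-trans (perSub-zero x ¬T⊂x) (≈-sym (perSpec-unitRows-zero T x ¬T⊂x))

  perSpec-unitRows-noninjective : ∀ T (x : Mono r (t ℕ.+ r) r) → ¬ Injective _≡_ _≡_ T →
                                  perSpec R t r (unitRows R T) x ≈ 0#
  perSpec-unitRows-noninjective T x ¬T-inj = perSpec-unitRows-zero T x λ (_ , _ , inj) → ¬T-inj (++-injectiveˡ inj)

  perSpec-multilinear : ∀ lam (x : Mono r (t ℕ.+ r) r) →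
    perSpec R t r lam x ≈ sumMaps R (λ π → prodF R (λ u → lam u (π u)) * perSpec R t r (unitRows R π) x)
  perSpec-multilinear lam (e , _) = ≈-sym (begin
    sumMaps R (λ π → L π * sumMaps R (perSpecTerm (unitRows R π) e))
      ≈⟨ sumMaps-cong R (λ π → *-distribˡ-sumMaps R (L π) (perSpecTerm (unitRows R π) e)) ⟩
    sumMaps R (λ π → sumMaps R (λ σ → L π * perSpecTerm (unitRows R π) e σ))
      ≈⟨ sumMaps-comm R (λ π σ → L π * perSpecTerm (unitRows R π) e σ) ⟩
    sumMaps R (λ σ → sumMaps R (λ π → L π * perSpecTerm (unitRows R π) e σ))
      ≈⟨ sumMaps-cong R (λ σ → sumMaps-cong R λ π → ≈-trans (*-congˡ (factor (unitRows R π) σ)) (x∙yz≈y∙xz _ _ _)) ⟩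
    sumMaps R (λ σ → sumMaps R (λ π → G σ * (L π * M π σ)))
      ≈⟨ sumMaps-cong R (λ σ → *-distribˡ-sumMaps R (G σ) (λ π → L π * M π σ)) ⟨
    sumMaps R (λ σ → G σ * sumMaps R (λ π → L π * M π σ))
      ≈⟨ sumMaps-cong R (λ σ → ≈-trans (*-congˡ (unitRows-sifting R lam (σ ∘ (_↑ˡ r)))) (≈-sym (factor lam σ))) ⟩
    sumMaps R (perSpecTerm lam e) ∎)
    where
    L : (Fin t → Fin (t ℕ.+ r)) → Carrier
    L π = prodF R (λ u → lam u (π u))
    M : (Fin t → Fin (t ℕ.+ r)) → (Fin (t ℕ.+ r) → Fin (t ℕ.+ r)) → Carrier
    M π σ = prodF R (λ u → unitRows R π u (σ (u ↑ˡ r)))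
    G : (Fin (t ℕ.+ r) → Fin (t ℕ.+ r)) → Carrier
    G σ = if isInj σ then (if isMonoOf (σ ∘ (t ↑ʳ_)) e then 1# else 0#) else 0#
    factor : ∀ lam′ σ → perSpecTerm lam′ e σ ≈ G σ * prodF R (λ u → lam′ u (σ (u ↑ˡ r)))
    factor lam′ σ with isInj σ | isMonoOf (σ ∘ (t ↑ʳ_)) e
    ... | true  | true  = ≈-sym (*-identityˡ _)
    ... | true  | false = ≈-sym (zeroˡ _)
    ... | false | _     = ≈-sym (zeroˡ _)

module _ {c ℓ} (R : CommutativeRing c ℓ) (t r : ℕ) where
  open CommutativeRing R renaming (refl to ≈-refl; sym to ≈-sym; trans to ≈-trans)

  SpecialisedPermanents : Pol R r (t ℕ.+ r) r → Set (c ⊔ ℓ)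
  SpecialisedPermanents q = ∃ λ (lam : Fin t → Fin (t ℕ.+ r) → Carrier) → ∀ x → q x ≈ perSpec R t r lam x

  SubPermanents : Pol R r (t ℕ.+ r) r → Set ℓ
  SubPermanents q =
    ∃ λ (col : Fin r → Fin (t ℕ.+ r)) → StrictlyIncreasing col × (∀ x → q x ≈ perSub R r (t ℕ.+ r) col x)

  subPermanent⇒specialised : ∀ {q} → SubPermanents q → SpecialisedPermanents q
  subPermanent⇒specialised (col , incr , q≈) =
    let T , _ , T∁col = complement-of-size refl col (increasing⇒injective incr)
    in unitRows R T , λ x → ≈-trans (q≈ x) (perSub≈perSpec-unitRows R T∁col x)

  perSpec-unitRows-inSpan : ∀ π → InSpan R SubPermanents (perSpec R t r (unitRows R π))
  perSpec-unitRows-inSpan π with isInj π in inj?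
  ... | true  = let col , incr , col∁π = complement-of-size (ℕₚ.+-comm r t) π (isInj-sound π inj?)
                in member⇒inSpan R SubPermanents
                     (col , incr , λ x → ≈-sym (perSub≈perSpec-unitRows R (complementary-sym col∁π) x))
  ... | false = inSpan-resp R SubPermanents (λ x → perSpec-unitRows-noninjective R π x (isInj-false π inj?))
                            (inSpan-zero R SubPermanents)

  specialised⇒inSpan-sub : ∀ {q} → SpecialisedPermanents q → InSpan R SubPermanents q
  specialised⇒inSpan-sub (lam , q≈) =
    inSpan-resp R SubPermanents (λ x → ≈-trans (q≈ x) (perSpec-multilinear R lam x))
      (inSpan-sumMaps R SubPermanents _ λ π → inSpan-scale R SubPermanents _ (perSpec-unitRows-inSpan π))

  span-specialised⇔span-sub : ∀ p → InSpan R SpecialisedPermanents p ⇔ InSpan R SubPermanents p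
  span-specialised⇔span-sub p =
    mk⇔ (inSpan-mono R SpecialisedPermanents SubPermanents specialised⇒inSpan-sub)
        (inSpan-mono R SubPermanents SpecialisedPermanents
          (member⇒inSpan R SpecialisedPermanents ∘ subPermanent⇒specialised))

module _ (t r : ℕ) where

  columns : Fin ((t ℕ.+ r) C r) → Fin r → Fin (t ℕ.+ r)
  columns = combination (t ℕ.+ r) r

  complement-of-columns : ∀ a → Σ (Fin t → Fin (t ℕ.+ r)) λ T → StrictlyIncreasing T × Complementary T (columns a)
  complement-of-columns a = complement-of-size refl (columns a) (increasing⇒injective (combination-increasing _ r a))

  rows : Fin ((t ℕ.+ r) C r) → Fin t → Fin (t ℕ.+ r)
  rows = proj₁ ∘ complement-of-columns

  rows∁columns : ∀ a → Complementary (rows a) (columns a)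
  rows∁columns = proj₂ ∘ proj₂ ∘ complement-of-columns

  rows-complete-columns : ∀ a → Completes (rows a) (exponentOf (columns a))
  rows-complete-columns a = columns a , isMonoOf-monomial (columns a) , ++-injective injectiveˡ injectiveʳ disjoint
    where open Complementary (rows∁columns a)

  rows-complete-only-columns : ∀ {a b} → a ≢ b → ¬ Completes (rows a) (exponentOf (columns b))
  -- A column of b missed by a is one of the rows of a, but ρ = columns b also takes it.
  rows-complete-only-columns {a} {b} a≢b (ρ , mono , inj)
    with combination-separates (t ℕ.+ r) r a≢b
  ... | v , a∌bv with Complementary.covering (rows∁columns a) (columns b v)
  ...   | inj₁ (w , Tw≡bv) =
    ++-disjoint inj w v (≡.trans Tw≡bv (≡.sym (isMonoOf-unique _ mono (isMonoOf-monomial (columns b)) v)))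
  ...   | inj₂ (u , au≡bv) = a∌bv u au≡bv

module _ {c ℓ} (R : CommutativeRing c ℓ) where
  open CommutativeRing R renaming (refl to ≈-refl; sym to ≈-sym; trans to ≈-trans)

  homMap-degree-one : ∀ {I : Set} s Cf (z : Fin s → Carrier) (x : I) →
                      homMap R s 1 Cf z x ≈ sumF R (λ i → z i * sumMaps R (λ h → Cf x (i ∷ h)))
  homMap-degree-one s Cf z x = sumF-cong R λ i → ≈-trans (*-comm _ _) (*-congʳ (*-identityʳ (z i)))

  perSpec-rows-columns : ∀ t r a b →
                         perSpec R t r (unitRows R (rows t r a)) (monomial (columns t r b)) ≈ unitRows R id a b
  perSpec-rows-columns t r a b with a Finₚ.≟ b
  ... | yes refl = perSpec-unitRows-one R _ (monomial (columns t r a)) (rows-complete-columns t r a)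
  ... | no a≢b   = perSpec-unitRows-zero R _ (monomial (columns t r b)) (rows-complete-only-columns t r a≢b)

  perSpec-weaklyElusive : IsField R → ∀ t r → WeaklyElusive R ((t ℕ.+ r) C r ∸ 1) 1 (perSpec R t r)
  perSpec-weaklyElusive F t r Cf image⊆Γ = ℕₚ.<⇒≱ (∸1< (some-combination (ℕₚ.m≤n+m r t)))
    (identity-factors⇒≤ R F ((λ a → proj₁ (image⊆Γ (unitRows R (rows t r a)))) , W , factorisation))
    where
    ∸1< : ∀ {K} → Fin K → K ∸ 1 < K
    ∸1< {suc K} _ = ℕₚ.n<1+n K
    W : Fin ((t ℕ.+ r) C r ∸ 1) → Fin ((t ℕ.+ r) C r) → Carrier
    W i b = sumMaps R (λ h → Cf (monomial (columns t r b)) (i ∷ h))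
    factorisation : ∀ a b → sumF R (λ i → proj₁ (image⊆Γ (unitRows R (rows t r a))) i * W i b) ≈ unitRows R id a b
    factorisation a b = let z , f≈Γz = image⊆Γ (unitRows R (rows t r a)) in begin
      sumF R (λ i → z i * W i b)                                  ≈⟨ homMap-degree-one _ Cf z _ ⟨
      homMap R _ 1 Cf z (monomial (columns t r b))                ≈⟨ f≈Γz _ ⟨
      perSpec R t r (unitRows R (rows t r a)) (monomial (columns t r b)) ≈⟨ perSpec-rows-columns t r a b ⟩
      unitRows R id a b                                           ∎
      where open import Relation.Binary.Reasoning.Setoid setoid

open import Data.Nat using (_+_)

lemma5p1 : ∀ {c ℓ} (R : CommutativeRing c ℓ) → IsField R → CharZero R →
    (t r : ℕ) → 2 ≤ t → 2 ≤ r →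
    (∀ (p : Pol R r (t + r) r) →
       InSpan R (λ q → ∃ λ (lam : Fin t → Fin (t + r) → CommutativeRing.Carrier R) → ∀ x → CommutativeRing._≈_ R (q x) (perSpec R t r lam x)) p
       ⇔
       InSpan R (λ q → ∃ λ (col : Fin r → Fin (t + r)) → StrictlyIncreasing col × (∀ x → CommutativeRing._≈_ R (q x) (perSub R r (t + r) col x))) p)
    × WeaklyElusive R (((t + r) C r) ∸ 1) 1 (perSpec R t r)
lemma5p1 R F _ t r _ _ = span-specialised⇔span-sub R t r , perSpec-weaklyElusive R F t r
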